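{- Let $w\in\mathcal L_{2,\infty}$. Suppose either (1) $w=w_0\rho\lambda w_1\lambda w_2\mu w_3$ with $D_{\rho,\lambda}(w_0)=1$, $w_1\in\mathcal L_{1,\infty}$, and $w_2\in\mathcal L_{2,\infty}$ generates a permutation that avoids $312$; or (2) $w=w_0\lambda\rho w_1\lambda w_2\mu w_3$ with $D_{\rho,\lambda}(w_0)=1$, $w_1\in\mathcal L_{1,\infty}$, and $w_2\in\mathcal L_{2,\infty}$ generates a permutation that avoids $312$. Then $w\notin\mathcal L$.
   Context: Token-passing system: tokens $1,\dots,m$ in an input queue in increasing order, a stack $A$ of capacity $2$ and a stack $B$ of unbounded capacity in series. Move $\rho$: next input token onto top of $A$; $\lambda$: top of $A$ onto top of $B$; $\mu$: top of $B$ to the output. A word $w\in\{\rho,\lambda,\mu\}^*$ generates the permutation $p$ if, starting from all tokens in input and empty stacks, all moves of $w$ are legal and at the end all tokens have been output in the order $p$. A permutation $p$ avoids $312$ if there are no indices $i<j<k$ with $p_j<p_k<p_i$. For a word $u$ and letters $a,b$, $D_{a,b}(u)$ = (number of $a$'s in $u$) minus (number of $b$'s in $u$). For $k\in\mathbb N$, $\mathcal L_{k,\infty}$ is the set of $w\in\{\rho,\lambda,\mu\}^*$ with $D_{\rho,\lambda}(u)\in[0,k]$ and $D_{\lambda,\mu}(u)\ge0$ for all prefixes $u$ of $w$, and $D_{\rho,\lambda}(w)=D_{\lambda,\mu}(w)=0$. The language $\mathcal L$ is the set of words $w\in\mathcal L_{2,\infty}$ that (i) do not contain the factor $\rho\mu$,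 (ii) do not have a prefix $w_0\rho\lambda w_1\lambda\mu$ with $w_1\in\mathcal L_{1,\infty}$ and $D_{\rho,\lambda}(w_0)=1$, and (iii) do not have a prefix $w_0\lambda\rho w_1\lambda\mu$ with $w_1\in\mathcal L_{1,\infty}$ and $D_{\rho,\lambda}(w_0)=1$. -}

module Defs where

open import Data.Nat using (ℕ; zero; suc; _<_; _≡ᵇ_)
open import Data.Nat as ℕ using ()
open import Data.Integer using (ℤ; +_; _-_; _≤_)
open import Data.List using (List; []; _∷_; _++_; length; lookup)
open import Data.Fin using (Fin)
import Data.Fin as Fin
open import Data.Bool using (true; false; _∧_)
open import Data.Maybe using (Maybe; just; nothing)
open import Data.Product using (Σ; ∃; _×_; _,_)
open import Relation.Binary.PropositionalEquality using (_≡_)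
open import Relation.Nullary using (¬_)

-- The three moves: ρ (input → A), λ′ (A → B), μ (B → output)
data Move : Set where
  ρ λ′ μ : Move

Word : Set
Word = List Move

_≟M_ : Move → Move → ℕ
ρ ≟M ρ = 1
λ′ ≟M λ′ = 1
μ ≟M μ = 1
_ ≟M _ = 0

count : Move → Word → ℕ
count a [] = 0
count a (b ∷ u) = (a ≟M b) ℕ.+ count a u

D : Move → Move → Word → ℤ
D a b u = + count a u - + count b u

record InLk (k : ℕ) (w : Word) : Set where
  field
    prefixes : ∀ (u v : Word) → u ++ v ≡ w →
      (+ 0 ≤ D ρ λ′ u) × (D ρ λ′ u ≤ + k) × (+ 0 ≤ D λ′ μ u)
    endρλ : D ρ λ′ w ≡ + 0
    endλμ : D λ′ μ w ≡ + 0

record InL (w : Word) : Set where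
  field
    inL2 : InLk 2 w
    noρμ : ¬ (∃ λ x → ∃ λ y → w ≡ x ++ ρ ∷ μ ∷ y)
    noII : ¬ (∃ λ w₀ → ∃ λ w₁ → ∃ λ r →
              (w ≡ w₀ ++ ρ ∷ λ′ ∷ w₁ ++ λ′ ∷ μ ∷ r) × InLk 1 w₁ × D ρ λ′ w₀ ≡ + 1)
    noIII : ¬ (∃ λ w₀ → ∃ λ w₁ → ∃ λ r →
              (w ≡ w₀ ++ λ′ ∷ ρ ∷ w₁ ++ λ′ ∷ μ ∷ r) × InLk 1 w₁ × D ρ λ′ w₀ ≡ + 1)

-- State: next input token, total number of tokens m, stack A (head = top),
-- stack B (head = top), output produced so far (in order).
run : (next m : ℕ) (A B : List ℕ) (out : List ℕ) → Word → Maybe (ℕ × List ℕ × List ℕ × List ℕ)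
run next m A B out [] = just (next , A , B , out)
run next m A B out (ρ ∷ w) with (next ℕ.≤ᵇ m) ∧ (length A ℕ.<ᵇ 2)
... | true = run (suc next) m (next ∷ A) B out w
... | false = nothing
run next m [] B out (λ′ ∷ w) = nothing
run next m (a ∷ A) B out (λ′ ∷ w) = run next m A (a ∷ B) out w
run next m A [] out (μ ∷ w) = nothing
run next m A (b ∷ B) out (μ ∷ w) = run next m A B (out ++ b ∷ []) w

-- w generates p: with tokens 1..m (m = length p) in the input, all moves of w
-- are legal and at the end every token has been output, in the order p.
Generates : Word → List ℕ → Set
Generates w p = run 1 (length p) [] [] [] w ≡ just (suc (length p) , [] , [] , p)

Avoids312 : List ℕ → Set
Avoids312 p = ∀ (i j k : Fin (length p)) → i Fin.< j → j Fin.< k →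
  ¬ ((lookup p j < lookup p k) × (lookup p k < lookup p i))

module Submission where

-- Lemma 3.7.  Call Q a *stem* if Q = w₀ρλw₁ or Q = w₀λρw₁ with D_{ρ,λ}(w₀) = 1 and w₁ ∈ 𝓛_{1,∞}; by
-- conditions (ii)/(iii) no word Q λ μ r lies in 𝓛.  We isolate the property of w₂ that is used
-- (EmptiesA: a Dyck excursion λβμ of stack B that starts with one token in A and contains no ρμ
-- leaves A empty) and prove ¬ (Q λ v μ r ∈ 𝓛) by well-founded induction on |v|.  A nonempty v splits,
-- at the first returns of the A- and B-heights, as ρ x λ v′ μ y; EmptiesA makes v′ ∈ 𝓛_{2,∞}, and either
-- x contains ρμ (excluded by (i)) or Q λ ρ x is again a stem -- of type (iii) if x ∈ 𝓛_{1,∞}, otherwise of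
-- type (ii) through the last ρλ of x -- so the induction hypothesis applies to v′.  Finally, a word
-- generating a 312-avoiding permutation has EmptiesA: in a run of the token machine, a token c left in A
-- after the excursion, the token pushed by its last ρ and the token t popped after it form a 312 pattern.

open import Defs
open import Data.Nat as ℕ using (ℕ; zero; suc)
import Data.Nat.Properties as ℕP
open import Data.Nat.Induction using (<-wellFounded)
open import Induction.WellFounded using (Acc; acc)
open import Data.Integer as ℤ using (ℤ; +_; -[1+_]; _+_; _-_; -_; _≤_; _<_; +≤+; +<+; -<+; -≤+)
import Data.Integer.Properties as ℤP
open import Data.Integer.Tactic.RingSolver using (solve-∀)
open import Data.List using (List; []; _∷_; _++_; length; lookup)
open import Data.List.Properties using (++-assoc; ++-identityʳ; ∷-injective; length-++; length-++-≤ˡ; length-++-≤ʳ)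
open import Data.List.Relation.Unary.All as All using (All; []; _∷_)
open import Data.List.Relation.Unary.Any using (here; there)
open import Data.List.Membership.Propositional using (_∈_; _∉_)
open import Data.List.Membership.Propositional.Properties using (∈-++⁺ˡ; ∈-++⁺ʳ; ∈-∃++)
open import Data.Fin using (Fin; zero; suc; toℕ)
open import Data.Bool using (true; false; _∧_)
open import Data.Maybe using (just)
open import Data.Product using (Σ; ∃; ∃₂; _×_; _,_; proj₁; proj₂; map₂)
open import Data.Sum using (_⊎_; inj₁; inj₂)
open import Data.Empty using (⊥; ⊥-elim)
open import Function using (_∘_)
open import Relation.Nullary using (¬_; yes; no)
open import Relation.Unary using (Decidable)
open import Relation.Binary.Definitions using (DecidableEquality)
open import Relation.Binary.PropositionalEquality

count-++ : ∀ a u v → count a (u ++ v) ≡ count a u ℕ.+ count a v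
count-++ a [] v = refl
count-++ a (c ∷ u) v = trans (cong ((a ≟M c) ℕ.+_) (count-++ a u v)) (sym (ℕP.+-assoc (a ≟M c) _ _))

D-++ : ∀ a b u v → D a b (u ++ v) ≡ D a b u + D a b v
D-++ a b u v
  rewrite count-++ a u v | count-++ b u v
        | ℤP.pos-+ (count a u) (count a v) | ℤP.pos-+ (count b u) (count b v)
  = regroup (+ count a u) (+ count a v) (+ count b u) (+ count b v)
  where
  regroup : ∀ w x y z → (w + x) - (y + z) ≡ (w - y) + (x - z)
  regroup = solve-∀

D-∷ : ∀ a b c u → D a b (c ∷ u) ≡ D a b (c ∷ []) + D a b u
D-∷ a b c u = D-++ a b (c ∷ []) u

bit : ∀ a c → a ≟M c ≡ 0 ⊎ (c ≡ a × a ≟M c ≡ 1)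
bit ρ ρ = inj₂ (refl , refl)
bit ρ λ′ = inj₁ refl
bit ρ μ = inj₁ refl
bit λ′ ρ = inj₁ refl
bit λ′ λ′ = inj₂ (refl , refl)
bit λ′ μ = inj₁ refl
bit μ ρ = inj₁ refl
bit μ λ′ = inj₁ refl
bit μ μ = inj₂ (refl , refl)

D-letter : ∀ {a b c x y} → a ≟M c ≡ x → b ≟M c ≡ y → D a b (c ∷ []) ≡ + (x ℕ.+ 0) - + (y ℕ.+ 0)
D-letter = cong₂ λ x y → + (x ℕ.+ 0) - + (y ℕ.+ 0)

data Letter (a b c : Move) : Set where
  up   : c ≡ a → D a b (c ∷ []) ≡ + 1 → Letter a b c
  flat : D a b (c ∷ []) ≡ + 0 → Letter a b c
  down : c ≡ b → D a b (c ∷ []) ≡ -[1+ 0 ] → Letter a b c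

letter : ∀ a b c → Letter a b c
letter a b c with bit a c | bit b c
... | inj₁ p          | inj₁ q          = flat (D-letter p q)
... | inj₂ (refl , p) | inj₁ q          = up refl (D-letter p q)
... | inj₁ p          | inj₂ (refl , q) = down refl (D-letter p q)
... | inj₂ (refl , p) | inj₂ (_ , q)    = flat (D-letter p q)

fall-step : ∀ {a b c} X → + 0 ≤ X → X + D a b (c ∷ []) < + 0 → X ≡ + 0 × c ≡ b
fall-step {a} {b} {c} (+ n) (+≤+ _) neg with letter a b c
... | up _ d = ⊥-elim (no-up (subst (λ t → + n + t < + 0) d neg))
  where no-up : ¬ (+ n + + 1 < + 0)
        no-up (+<+ ())
... | flat d = ⊥-elim (no-flat (subst (λ t → + n + t < + 0) d neg))
  where no-flat : ¬ (+ n + + 0 < + 0)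
        no-flat (+<+ ())
... | down c≡b d = at-zero n (subst (λ t → + n + t < + 0) d neg) , c≡b
  where at-zero : ∀ n → + n + -[1+ 0 ] < + 0 → + n ≡ + 0
        at-zero zero _ = refl
        at-zero (suc n) (+<+ ())

rise-step : ∀ {a b c} X → X ≤ + 0 → + 0 < D a b (c ∷ []) + X → X ≡ + 0 × c ≡ a
rise-step {a} {b} {c} X X≤0 pos with letter a b c
... | up c≡a d = at-zero X X≤0 (subst (λ t → + 0 < t + X) d pos) , c≡a
  where at-zero : ∀ X → X ≤ + 0 → + 0 < + 1 + X → X ≡ + 0
        at-zero (+ zero) _ _ = refl
        at-zero (+ suc _) (+≤+ ()) _
        at-zero -[1+ zero ] _ (+<+ ())
        at-zero -[1+ suc _ ] _ ()
... | flat d = ⊥-elim (ℤP.<⇒≱ (subst (+ 0 <_) (ℤP.+-identityˡ X) (subst (λ t → + 0 < t + X) d pos)) X≤0)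
... | down _ d = ⊥-elim (no-down X X≤0 (subst (λ t → + 0 < t + X) d pos))
  where no-down : ∀ X → X ≤ + 0 → ¬ (+ 0 < -[1+ 0 ] + X)
        no-down (+ zero) _ ()
        no-down (+ suc _) (+≤+ ()) _
        no-down -[1+ _ ] _ ()

complement-nonneg : ∀ {X Y} → X + Y ≡ + 0 → Y ≤ + 0 → + 0 ≤ X
complement-nonneg {X} {Y} sum0 Y≤0 =
  subst (+ 0 ≤_) (trans (sym (ℤP.+-identityˡ (- Y))) (trans (cong (_- Y) (sym sum0)) (cancel X Y)))
        (ℤP.neg-mono-≤ Y≤0)
  where cancel : ∀ X Y → (X + Y) - Y ≡ X
        cancel = solve-∀

+-cancelʳ : ∀ {X Y} k → X + k ≡ Y + k → X ≡ Y
+-cancelʳ {X} {Y} k eq = trans (sym (cancel X k)) (trans (cong (_- k) eq) (cancel Y k))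
  where cancel : ∀ X k → (X + k) - k ≡ X
        cancel = solve-∀

one≤ : ∀ X → + 0 ≤ X + -[1+ 0 ] → + 1 ≤ X
one≤ (+ suc n) _ = +≤+ (ℕ.s≤s ℕ.z≤n)
one≤ (+ zero) ()
one≤ -[1+ n ] ()

negative-rest : ∀ {X Y} → + 0 ≤ X → X + (+ 1 + Y) ≡ + 0 → Y < + 0
negative-rest {+ n} {Y} (+≤+ _) sum0 = subst (_< + 0) (sym Y≡) -<+
  where
  isolate : ∀ X Y → Y ≡ (X + (+ 1 + Y)) - (+ 1 + X)
  isolate = solve-∀
  Y≡ : Y ≡ -[1+ n ]
  Y≡ = trans (isolate (+ n) Y) (cong (_- (+ 1 + + n)) sum0)

below-2 : ∀ X → + 1 + X ≤ + 2 → X ≤ + 1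
below-2 (+ n) (+≤+ (ℕ.s≤s n≤1)) = +≤+ n≤1
below-2 -[1+ n ] _ = -≤+

module _ {A : Set} where

  Prefixes Suffixes : (List A → Set) → List A → Set
  Prefixes P w = ∀ u v → u ++ v ≡ w → P u
  Suffixes P w = ∀ u v → u ++ v ≡ w → P v

  prefixes-infix : ∀ {P} pre z post → Prefixes P (pre ++ z ++ post) → Prefixes (λ u → P (pre ++ u)) z
  prefixes-infix pre z post all u v refl =
    all (pre ++ u) (v ++ post) (trans (++-assoc pre u (v ++ post)) (cong (pre ++_) (sym (++-assoc u v post))))

  prefixes-[] : ∀ {P} → P [] → Prefixes P []
  prefixes-[] p [] _ _ = p

  prefixes-∷ : ∀ {P c z} → P [] → Prefixes (λ u → P (c ∷ u)) z → Prefixes P (c ∷ z)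
  prefixes-∷ p _ [] _ _ = p
  prefixes-∷ _ all (_ ∷ u) v e with ∷-injective e
  ... | refl , e′ = all u v e′

  suffixes-∷ : ∀ {P c z} → P (c ∷ z) → Suffixes P z → Suffixes P (c ∷ z)
  suffixes-∷ p _ [] _ refl = p
  suffixes-∷ _ all (_ ∷ u) v e = all u v (proj₂ (∷-injective e))

  first-failure : ∀ {P} → Decidable P → P [] → ∀ z →
    Prefixes P z ⊎ ∃₂ λ z₁ c → ∃ λ z₂ → z ≡ z₁ ++ c ∷ z₂ × Prefixes P z₁ × ¬ P (z₁ ++ c ∷ [])
  first-failure P? p [] = inj₁ (prefixes-[] p)
  first-failure P? p (c ∷ z) with P? (c ∷ [])
  ... | no ¬pc = inj₂ ([] , c , z , refl , prefixes-[] p , ¬pc)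
  ... | yes pc with first-failure (λ u → P? (c ∷ u)) pc z
  ...   | inj₁ all = inj₁ (prefixes-∷ p all)
  ...   | inj₂ (z₁ , c′ , z₂ , refl , all , fail) = inj₂ (c ∷ z₁ , c′ , z₂ , refl , prefixes-∷ p all , fail)

  last-failure : ∀ {P} → Decidable P → P [] → ∀ z →
    Suffixes P z ⊎ ∃₂ λ z₁ c → ∃ λ z₂ → z ≡ z₁ ++ c ∷ z₂ × Suffixes P z₂ × ¬ P (c ∷ z₂)
  last-failure P? p [] = inj₁ λ { [] _ refl → p }
  last-failure P? p (c ∷ z) with last-failure P? p z
  ... | inj₂ (z₁ , c′ , z₂ , refl , all , fail) = inj₂ (c ∷ z₁ , c′ , z₂ , refl , all , fail)
  ... | inj₁ all with P? (c ∷ z)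
  ...   | yes pcz = inj₁ (suffixes-∷ pcz all)
  ...   | no ¬pcz = inj₂ ([] , c , z , refl , all , ¬pcz)

Dyck : Move → Move → Word → Set
Dyck a b z = Prefixes (λ u → + 0 ≤ D a b u) z × D a b z ≡ + 0

first-return : ∀ a b z → D a b z < + 0 → ∃₂ λ z₁ z₂ → z ≡ z₁ ++ b ∷ z₂ × Dyck a b z₁
first-return a b z neg with first-failure (λ u → + 0 ℤP.≤? D a b u) ℤP.≤-refl z
... | inj₁ all = ⊥-elim (ℤP.<⇒≱ neg (all z [] (++-identityʳ z)))
... | inj₂ (z₁ , c , z₂ , refl , all , fail)
  with fall-step {a} {b} {c} (D a b z₁) (all z₁ [] (++-identityʳ z₁))
         (subst (_< + 0) (D-++ a b z₁ (c ∷ [])) (ℤP.≰⇒> fail))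
... | z₁-level , refl = z₁ , z₂ , refl , all , z₁-level

last-rise : ∀ a b z → + 0 < D a b z → ∃₂ λ z₁ z₂ → z ≡ z₁ ++ a ∷ z₂ × Dyck a b z₂
last-rise a b z pos with last-failure (λ v → D a b v ℤP.≤? + 0) ℤP.≤-refl z
... | inj₁ all = ⊥-elim (ℤP.<⇒≱ pos (all [] z refl))
... | inj₂ (z₁ , c , z₂ , refl , all , fail)
  with rise-step {a} {b} {c} (D a b z₂) (all [] z₂ refl) (subst (+ 0 <_) (D-∷ a b c z₂) (ℤP.≰⇒> fail))
... | z₂-level , refl = z₁ , z₂ , refl , nonneg , z₂-level
  where
  nonneg : Prefixes (λ u → + 0 ≤ D a b u) z₂
  nonneg u v refl = complement-nonneg (trans (sym (D-++ a b u v)) z₂-level) (all u v refl)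

above-∷ : ∀ a b o c u → Prefixes (λ v → + 0 ≤ o + D a b v) (c ∷ u) →
  Prefixes (λ v → + 0 ≤ (o + D a b (c ∷ [])) + D a b v) u
above-∷ a b o c u above v w e =
  subst (+ 0 ≤_) (trans (cong (λ t → o + t) (D-∷ a b c v)) (sym (ℤP.+-assoc o _ _))) (above (c ∷ v) w (cong (c ∷_) e))

-- hA u and hB u are the numbers of tokens in the stacks A and B after the moves u.
hA hB : Word → ℤ
hA = D ρ λ′
hB = D λ′ μ

Strip : ℕ → Word → Set
Strip k u = (+ 0 ≤ hA u) × (hA u ≤ + k) × (+ 0 ≤ hB u)

Walk : ℕ → Word → Set
Walk k = Prefixes (Strip k)

after-λ : ∀ pre u → hA pre ≡ + 1 → hA (pre ++ λ′ ∷ u) ≡ hA u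
after-λ pre u h1 = begin
  hA (pre ++ λ′ ∷ u)         ≡⟨ D-++ ρ λ′ pre (λ′ ∷ u) ⟩
  hA pre + hA (λ′ ∷ u)       ≡⟨ cong₂ _+_ h1 (D-∷ ρ λ′ λ′ u) ⟩
  + 1 + (-[1+ 0 ] + hA u)    ≡⟨ cancel (hA u) ⟩
  hA u                       ∎
  where open ≡-Reasoning
        cancel : ∀ X → + 1 + (-[1+ 0 ] + X) ≡ X
        cancel = solve-∀

inLk-after-λ : ∀ {k} pre z post → Walk k (pre ++ λ′ ∷ z ++ post) → hA pre ≡ + 1 →
  hA z ≡ + 0 → Dyck λ′ μ z → InLk k z
inLk-after-λ {k} pre z post walk h1 z-level (nonneg , z-balanced) = record
  { prefixes = λ u v e → strip u (prefixes-infix (pre ++ λ′ ∷ []) z post walk′ u v e) (nonneg u v e)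
  ; endρλ = z-level
  ; endλμ = z-balanced }
  where
  walk′ : Walk k ((pre ++ λ′ ∷ []) ++ z ++ post)
  walk′ = subst (Walk k) (sym (++-assoc pre (λ′ ∷ []) (z ++ post))) walk
  strip : ∀ u → Strip k ((pre ++ λ′ ∷ []) ++ u) → + 0 ≤ hB u → Strip k u
  strip u (lo , hi , _) b rewrite ++-assoc pre (λ′ ∷ []) u | after-λ pre u h1 = lo , hi , b

HasRM : Word → Set
HasRM w = ∃₂ λ x y → w ≡ x ++ ρ ∷ μ ∷ y

HasRM-++ˡ : ∀ {u} v → HasRM u → HasRM (u ++ v)
HasRM-++ˡ v (x , y , refl) = x , y ++ v , ++-assoc x (ρ ∷ μ ∷ y) v

HasRM-++ʳ : ∀ u {v} → HasRM v → HasRM (u ++ v)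
HasRM-++ʳ u (x , y , refl) = u ++ x , y , sym (++-assoc u x (ρ ∷ μ ∷ y))

-- A walk of A-height at most 1 that ends at height 1 ends with its last ρ, unless it contains ρμ:
-- after the last rise only μ's can follow.
top-ρ : ∀ z → hA z ≡ + 1 → Prefixes (λ u → hA u ≤ + 1) z →
  (∃ λ z₁ → z ≡ z₁ ++ ρ ∷ [] × hA z₁ ≡ + 0) ⊎ HasRM z
top-ρ z z-level below with last-rise ρ λ′ z (subst (+ 0 <_) (sym z-level) (+<+ (ℕ.s≤s ℕ.z≤n)))
... | z₁ , z₂ , refl , nonneg , z₂-level = after-last-ρ z₂ z₁-level nonneg below
  where
  z₁-level : hA z₁ ≡ + 0
  z₁-level = +-cancelʳ {Y = + 0} (+ 1) (begin
    hA z₁ + + 1              ≡⟨ cong (λ t → hA z₁ + (+ 1 + t)) (sym z₂-level) ⟩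
    hA z₁ + (+ 1 + hA z₂)    ≡⟨ cong (λ t → hA z₁ + t) (sym (D-∷ ρ λ′ ρ z₂)) ⟩
    hA z₁ + hA (ρ ∷ z₂)      ≡⟨ sym (D-++ ρ λ′ z₁ (ρ ∷ z₂)) ⟩
    hA (z₁ ++ ρ ∷ z₂)        ≡⟨ z-level ⟩
    + 1                      ∎)
    where open ≡-Reasoning
  after-last-ρ : ∀ z₂ → hA z₁ ≡ + 0 → Prefixes (λ u → + 0 ≤ hA u) z₂ → Prefixes (λ u → hA u ≤ + 1) (z₁ ++ ρ ∷ z₂) →
    (∃ λ z₁′ → z₁ ++ ρ ∷ z₂ ≡ z₁′ ++ ρ ∷ [] × hA z₁′ ≡ + 0) ⊎ HasRM (z₁ ++ ρ ∷ z₂)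
  after-last-ρ [] z₁0 _ _ = inj₁ (z₁ , refl , z₁0)
  after-last-ρ (μ ∷ z₃) _ _ _ = inj₂ (z₁ , z₃ , refl)
  after-last-ρ (λ′ ∷ z₃) _ nonneg _ with nonneg (λ′ ∷ []) z₃ refl
  ... | ()
  after-last-ρ (ρ ∷ z₃) z₁0 _ below′ with subst (_≤ + 1) (trans (D-++ ρ λ′ z₁ (ρ ∷ ρ ∷ [])) (cong (_+ + 2) z₁0))
                                        (below′ (z₁ ++ ρ ∷ ρ ∷ []) z₃ (++-assoc z₁ (ρ ∷ ρ ∷ []) z₃))
  ... | +≤+ (ℕ.s≤s ())

data Stem : Word → Set where
  via-ρλ : ∀ {w₀ w₁} → D ρ λ′ w₀ ≡ + 1 → InLk 1 w₁ → Stem (w₀ ++ ρ ∷ λ′ ∷ w₁)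
  via-λρ : ∀ {w₀ w₁} → D ρ λ′ w₀ ≡ + 1 → InLk 1 w₁ → Stem (w₀ ++ λ′ ∷ ρ ∷ w₁)

stem-blocks : ∀ {Q} → Stem Q → ∀ r → ¬ InL (Q ++ λ′ ∷ μ ∷ r)
stem-blocks (via-ρλ {w₀} {w₁} h1 w₁∈L) r inL =
  InL.noII inL (w₀ , w₁ , r , ++-assoc w₀ (ρ ∷ λ′ ∷ w₁) (λ′ ∷ μ ∷ r) , w₁∈L , h1)
stem-blocks (via-λρ {w₀} {w₁} h1 w₁∈L) r inL =
  InL.noIII inL (w₀ , w₁ , r , ++-assoc w₀ (λ′ ∷ ρ ∷ w₁) (λ′ ∷ μ ∷ r) , w₁∈L , h1)

hA-swap : ∀ w₀ c d w₁ → hA (c ∷ d ∷ []) ≡ + 0 → hA w₀ ≡ + 1 → hA w₁ ≡ + 0 → hA (w₀ ++ c ∷ d ∷ w₁) ≡ + 1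
hA-swap w₀ c d w₁ cd0 h1 h0 = begin
  hA (w₀ ++ c ∷ d ∷ w₁)                 ≡⟨ D-++ ρ λ′ w₀ (c ∷ d ∷ w₁) ⟩
  hA w₀ + hA (c ∷ d ∷ w₁)               ≡⟨ cong (λ t → hA w₀ + t) (D-++ ρ λ′ (c ∷ d ∷ []) w₁) ⟩
  hA w₀ + (hA (c ∷ d ∷ []) + hA w₁)     ≡⟨ cong₂ (λ s t → s + (t + hA w₁)) h1 cd0 ⟩
  + 1 + (+ 0 + hA w₁)                   ≡⟨ cong (λ t → + 1 + (+ 0 + t)) h0 ⟩
  + 1                                   ∎
  where open ≡-Reasoning

stem-height : ∀ {Q} → Stem Q → hA Q ≡ + 1
stem-height (via-ρλ {w₀} {w₁} h1 w₁∈L) = hA-swap w₀ ρ λ′ w₁ refl h1 (InLk.endρλ w₁∈L)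
stem-height (via-λρ {w₀} {w₁} h1 w₁∈L) = hA-swap w₀ λ′ ρ w₁ refl h1 (InLk.endρλ w₁∈L)

-- If x ends above its B-level, split x at the last rise of B: x = y λ′ x₂ with x₂ Dyck for B; then
-- y = x₁ ρ (or x contains ρμ) and Q λ′ ρ x₁ ρ λ′ x₂ is a stem of type (ii).
stem-extend-rising : ∀ {Q} y x₂ → Stem Q → Walk 1 (y ++ λ′ ∷ x₂) → hA (y ++ λ′ ∷ x₂) ≡ + 0 →
  Dyck λ′ μ x₂ → Stem (Q ++ λ′ ∷ ρ ∷ y ++ λ′ ∷ x₂) ⊎ HasRM (y ++ λ′ ∷ x₂)
stem-extend-rising {Q} y x₂ stem walk x-level dyck₂ with top-ρ y y-level below
  where
  y-level : hA y ≡ + 1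
  y-level = ℤP.≤-antisym (proj₁ (proj₂ (walk y (λ′ ∷ x₂) refl)))
    (one≤ (hA y) (subst (+ 0 ≤_) (D-++ ρ λ′ y (λ′ ∷ []))
      (proj₁ (walk (y ++ λ′ ∷ []) x₂ (++-assoc y (λ′ ∷ []) x₂)))))
  below : Prefixes (λ u → hA u ≤ + 1) y
  below u v e = proj₁ (proj₂ (prefixes-infix [] y (λ′ ∷ x₂) walk u v e))
... | inj₂ ρμ = inj₂ (HasRM-++ˡ (λ′ ∷ x₂) ρμ)
... | inj₁ (x₁ , refl , x₁-level) = inj₁ (subst Stem regroup (via-ρλ {Q ++ λ′ ∷ ρ ∷ x₁} {x₂} new-level x₂∈L₁))
  where
  new-level : hA (Q ++ λ′ ∷ ρ ∷ x₁) ≡ + 1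
  new-level = hA-swap Q λ′ ρ x₁ refl (stem-height stem) x₁-level
  x₁ρ-level : hA (x₁ ++ ρ ∷ []) ≡ + 1
  x₁ρ-level = trans (D-++ ρ λ′ x₁ (ρ ∷ [])) (cong (_+ + 1) x₁-level)
  x₂∈L₁ : InLk 1 x₂
  x₂∈L₁ = inLk-after-λ (x₁ ++ ρ ∷ []) x₂ []
    (subst (λ t → Walk 1 ((x₁ ++ ρ ∷ []) ++ λ′ ∷ t)) (sym (++-identityʳ x₂)) walk) x₁ρ-level
    (trans (sym (after-λ (x₁ ++ ρ ∷ []) x₂ x₁ρ-level)) x-level) dyck₂
  regroup : (Q ++ λ′ ∷ ρ ∷ x₁) ++ ρ ∷ λ′ ∷ x₂ ≡ Q ++ λ′ ∷ ρ ∷ (x₁ ++ ρ ∷ []) ++ λ′ ∷ x₂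
  regroup = trans (++-assoc Q (λ′ ∷ ρ ∷ x₁) (ρ ∷ λ′ ∷ x₂))
                  (cong (λ t → Q ++ λ′ ∷ ρ ∷ t) (sym (++-assoc x₁ (ρ ∷ []) (λ′ ∷ x₂))))

-- Extending a stem Q by λ′ ρ x, for an A-closed walk x of height ≤ 1, gives a stem again unless x contains
-- ρμ: of type (iii) if x is also B-closed, and of type (ii) otherwise.
stem-extend : ∀ {Q} x → Stem Q → Walk 1 x → hA x ≡ + 0 → Stem (Q ++ λ′ ∷ ρ ∷ x) ⊎ HasRM x
stem-extend x stem walk x-level with + 0 ℤP.<? hB x
... | yes rising with last-rise λ′ μ x rising
...   | y , x₂ , refl , dyck₂ = stem-extend-rising y x₂ stem walk x-level dyck₂
stem-extend x stem walk x-level | no ¬rising =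
  inj₁ (via-λρ (stem-height stem) record { prefixes = walk ; endρλ = x-level ; endλμ = x-balanced })
  where
  x-balanced : hB x ≡ + 0
  x-balanced = ℤP.≤-antisym (ℤP.≮⇒≥ ¬rising) (proj₂ (proj₂ (walk x [] (++-identityʳ x))))

-- The token machine as a transition relation on configurations (next input token, A, B, output; tops at
-- the heads).  It forgets the capacity and input-length guards of `run`, which the argument never uses.
Config : Set
Config = ℕ × List ℕ × List ℕ × List ℕ

stackA stackB output : Config → List ℕ
stackA (_ , A , _ , _) = A
stackB (_ , _ , B , _) = B
output (_ , _ , _ , O) = O

data Step : Config → Move → Config → Set where
  push : ∀ {n A B O}   → Step (n , A , B , O) ρ (suc n , n ∷ A , B , O)
  move : ∀ {n a A B O} → Step (n , a ∷ A , B , O) λ′ (n , A , a ∷ B , O)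
  pop  : ∀ {n A b B O} → Step (n , A , b ∷ B , O) μ (n , A , B , O ++ b ∷ [])

infixr 5 _▸_
data Run : Config → Word → Config → Set where
  done : ∀ {s} → Run s [] s
  _▸_  : ∀ {s c s₁ u s₂} → Step s c s₁ → Run s₁ u s₂ → Run s (c ∷ u) s₂

run-sound : ∀ {m} n A B O w {s} → run n m A B O w ≡ just s → Run (n , A , B , O) w s
run-sound n A B O [] refl = done
run-sound {m} n A B O (ρ ∷ w) h with (n ℕ.≤ᵇ m) ∧ (length A ℕ.<ᵇ 2)
... | true = push ▸ run-sound (suc n) (n ∷ A) B O w h
run-sound n A B O (ρ ∷ w) () | false
run-sound n [] B O (λ′ ∷ w) ()
run-sound n (a ∷ A) B O (λ′ ∷ w) h = move ▸ run-sound n A (a ∷ B) O w h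
run-sound n A [] O (μ ∷ w) ()
run-sound n A (b ∷ B) O (μ ∷ w) h = pop ▸ run-sound n A B (O ++ b ∷ []) w h

run-split : ∀ u {v s s′} → Run s (u ++ v) s′ → ∃ λ s₁ → Run s u s₁ × Run s₁ v s′
run-split [] r = _ , done , r
run-split (c ∷ u) (step ▸ r) with run-split u r
... | s₁ , r₁ , r₂ = s₁ , step ▸ r₁ , r₂

run-invariant : ∀ {I : Config → Set} → (∀ {s c s₁} → Step s c s₁ → I s → I s₁) →
  ∀ {s u s′} → Run s u s′ → I s → I s′
run-invariant keep done i = i
run-invariant keep (step ▸ r) i = run-invariant keep r (keep step i)

A-step : ∀ {s c s₁} → Step s c s₁ → + length (stackA s₁) ≡ + length (stackA s) + hA (c ∷ [])
A-step (push {A = A}) = ℤP.+-comm (+ 1) (+ length A)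
A-step move = refl
A-step pop = sym (ℤP.+-identityʳ _)

A-height : ∀ {s u s′} → Run s u s′ → + length (stackA s′) ≡ + length (stackA s) + hA u
A-height done = sym (ℤP.+-identityʳ _)
A-height {s} {c ∷ u} {s′} (_▸_ {s₁ = s₁} step r) = begin
  + length (stackA s′)                             ≡⟨ A-height r ⟩
  + length (stackA s₁) + hA u                      ≡⟨ cong (_+ hA u) (A-step step) ⟩
  + length (stackA s) + hA (c ∷ []) + hA u         ≡⟨ ℤP.+-assoc (+ length (stackA s)) (hA (c ∷ [])) (hA u) ⟩
  + length (stackA s) + (hA (c ∷ []) + hA u)       ≡⟨ cong (λ t → + length (stackA s) + t) (sym (D-∷ ρ λ′ c u)) ⟩
  + length (stackA s) + hA (c ∷ u)                 ∎
  where open ≡-Reasoning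

-- Stack discipline of B: while the B-height stays above −|Y|, the part B₀ below the top segment Y of B
-- is untouched, and the segment above B₀ has size |Y| + hB.
B-step : ∀ {s c s₁} Y {B₀ o} → Step s c s₁ → stackB s ≡ Y ++ B₀ → + length Y ≡ o → + 0 ≤ o + hB (c ∷ []) →
  ∃ λ Y′ → stackB s₁ ≡ Y′ ++ B₀ × + length Y′ ≡ o + hB (c ∷ [])
B-step Y push eq len _ = Y , eq , trans len (sym (ℤP.+-identityʳ _))
B-step Y (move {a = a}) eq len _ = a ∷ Y , cong (a ∷_) eq , trans (ℤP.+-comm (+ 1) (+ length Y)) (cong (_+ + 1) len)
B-step [] pop refl refl ()
B-step (y ∷ Y) pop eq len _ with ∷-injective eq
... | refl , eq′ = Y , eq′ , cong (_+ -[1+ 0 ]) len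

B-frame : ∀ {s u s′} Y {B₀ o} → stackB s ≡ Y ++ B₀ → + length Y ≡ o → Prefixes (λ v → + 0 ≤ o + hB v) u →
  Run s u s′ → ∃ λ X → stackB s′ ≡ X ++ B₀ × + length X ≡ o + hB u
B-frame Y eq len _ done = Y , eq , trans len (sym (ℤP.+-identityʳ _))
B-frame {u = c ∷ u} Y {o = o} eq len above (step ▸ r) with B-step Y step eq len (above (c ∷ []) u refl)
... | Y′ , eq′ , len′ with B-frame Y′ eq′ len′ (above-∷ λ′ μ o c u above) r
...   | X , eqX , lenX = X , eqX , trans lenX (trans (ℤP.+-assoc o _ _) (cong (λ t → o + t) (sym (D-∷ λ′ μ c u))))

Window : ℕ → Config → Set
Window lo (n , A , B , _) = lo ℕ.≤ n × All (λ a → lo ℕ.≤ a × a ℕ.< n) A × All (ℕ._< n) B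

window-step : ∀ {lo s c s₁} → Step s c s₁ → Window lo s → Window lo s₁
window-step push (lo≤n , A-ok , B-ok) =
  ℕP.m≤n⇒m≤1+n lo≤n , (lo≤n , ℕP.n<1+n _) ∷ All.map (map₂ ℕP.m<n⇒m<1+n) A-ok , All.map ℕP.m<n⇒m<1+n B-ok
window-step move (lo≤n , (_ , a<n) ∷ A-ok , B-ok) = lo≤n , A-ok , a<n ∷ B-ok
window-step pop (lo≤n , A-ok , _ ∷ B-ok) = lo≤n , A-ok , B-ok

-- Without ρ nothing enters A, so the final A is a bottom part of the initial one.
no-push : ∀ {s u s′} → Run s u s′ → ρ ∉ u → ∃ λ Y → stackA s ≡ Y ++ stackA s′
no-push done _ = [] , refl
no-push (push ▸ r) ρ∉u = ⊥-elim (ρ∉u (here refl))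
no-push (move {a = a} ▸ r) ρ∉u with no-push r (ρ∉u ∘ there)
... | Y , eq = a ∷ Y , cong (a ∷_) eq
no-push (pop ▸ r) ρ∉u = no-push r (ρ∉u ∘ there)

OnStack : Config → ℕ → Set
OnStack s x = x ∈ stackA s ⊎ x ∈ stackB s

Outputs : Config → List ℕ → Config → Set
Outputs s Δ s′ = output s′ ≡ output s ++ Δ × (∀ {x} → OnStack s x → x ∈ Δ ⊎ OnStack s′ x)

conserve-step : ∀ {s c s₁} → Step s c s₁ → ∃ λ δ → Outputs s δ s₁
conserve-step push = [] , sym (++-identityʳ _) , λ { (inj₁ x∈A) → inj₂ (inj₁ (there x∈A)) ; (inj₂ x∈B) → inj₂ (inj₂ x∈B) }
conserve-step move = [] , sym (++-identityʳ _) , λ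
  { (inj₁ (here x≡a)) → inj₂ (inj₂ (here x≡a)) ; (inj₁ (there x∈A)) → inj₂ (inj₁ x∈A) ; (inj₂ x∈B) → inj₂ (inj₂ (there x∈B)) }
conserve-step pop = _ ∷ [] , refl , λ
  { (inj₁ x∈A) → inj₂ (inj₁ x∈A) ; (inj₂ (here x≡b)) → inj₁ (here x≡b) ; (inj₂ (there x∈B)) → inj₂ (inj₂ x∈B) }

conservation : ∀ {s u s′} → Run s u s′ → ∃ λ Δ → Outputs s Δ s′
conservation done = [] , sym (++-identityʳ _) , inj₂
conservation {s} {s′ = s′} (step ▸ r) with conserve-step step | conservation r
... | δ , out₁ , keep₁ | Δ , out₂ , keep₂ =
  δ ++ Δ , trans out₂ (trans (cong (_++ Δ) out₁) (++-assoc (output s) δ Δ)) , keep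
  where
  keep : ∀ {x} → OnStack s x → x ∈ δ ++ Δ ⊎ OnStack s′ x
  keep on with keep₁ on
  ... | inj₁ x∈δ = inj₁ (∈-++⁺ˡ x∈δ)
  ... | inj₂ on₁ with keep₂ on₁
  ...   | inj₁ x∈Δ = inj₁ (∈-++⁺ʳ δ x∈Δ)
  ...   | inj₂ on′ = inj₂ on′

position : ∀ {p : List ℕ} xs y ys → p ≡ xs ++ y ∷ ys → Σ (Fin (length p)) λ i → lookup p i ≡ y × toℕ i ≡ length xs
position [] y ys refl = zero , refl , refl
position (x ∷ xs) y ys refl with position xs y ys refl
... | i , at-i , i≡ = suc i , at-i , cong suc i≡

length-< : ∀ (xs : List ℕ) y ys → length xs ℕ.< length (xs ++ y ∷ ys)
length-< xs y ys = subst (length xs ℕ.<_) (sym (length-++ xs)) (ℕP.m<m+n (length xs) (ℕ.s≤s ℕ.z≤n))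

no-312 : ∀ {xs ys t e c} → Avoids312 (xs ++ t ∷ ys) → e ∈ xs → c ∈ ys → t ℕ.< c → c ℕ.< e → ⊥
no-312 avoids e∈xs c∈ys t<c c<e with ∈-∃++ e∈xs | ∈-∃++ c∈ys
... | x₁ , x₂ , refl | y₁ , y₂ , refl
  with position x₁ _ (x₂ ++ _ ∷ y₁ ++ _ ∷ y₂) (++-assoc x₁ (_ ∷ x₂) (_ ∷ y₁ ++ _ ∷ y₂))
     | position (x₁ ++ _ ∷ x₂) _ (y₁ ++ _ ∷ y₂) refl
     | position ((x₁ ++ _ ∷ x₂) ++ _ ∷ y₁) _ y₂ (sym (++-assoc (x₁ ++ _ ∷ x₂) (_ ∷ y₁) (_ ∷ y₂)))
... | i , at-i , i≡ | j , at-j , j≡ | k , at-k , k≡ =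
  avoids i j k (subst₂ ℕ._<_ (sym i≡) (sym j≡) (length-< x₁ _ x₂))
               (subst₂ ℕ._<_ (sym j≡) (sym k≡) (length-< (x₁ ++ _ ∷ x₂) _ y₁))
               (subst₂ ℕ._<_ (sym at-j) (sym at-k) t<c , subst₂ ℕ._<_ (sym at-k) (sym at-i) c<e)

_≟_ : DecidableEquality Move
ρ ≟ ρ = yes refl
λ′ ≟ λ′ = yes refl
μ ≟ μ = yes refl
ρ ≟ λ′ = no λ ()
ρ ≟ μ = no λ ()
λ′ ≟ ρ = no λ ()
λ′ ≟ μ = no λ ()
μ ≟ ρ = no λ ()
μ ≟ λ′ = no λ ()

module _ {A : Set} (_≟ᴬ_ : DecidableEquality A) where
  last-occurrence : ∀ (a : A) z → a ∉ z ⊎ ∃₂ λ z₁ z₂ → z ≡ z₁ ++ a ∷ z₂ × a ∉ z₂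
  last-occurrence a [] = inj₁ λ ()
  last-occurrence a (c ∷ z) with last-occurrence a z
  ... | inj₂ (z₁ , z₂ , refl , a∉z₂) = inj₂ (c ∷ z₁ , z₂ , refl , a∉z₂)
  ... | inj₁ a∉z with a ≟ᴬ c
  ...   | yes refl = inj₂ ([] , z , refl , a∉z)
  ...   | no a≢c = inj₁ λ { (here a≡c) → a≢c a≡c ; (there a∈z) → a∉z a∈z }

EmptiesA : Word → Set
EmptiesA v = ∀ α β γ → v ≡ α ++ λ′ ∷ β ++ μ ∷ γ → hA α ≡ + 1 → Dyck λ′ μ β →
  ¬ HasRM (β ++ μ ∷ []) → hA β ≡ + 0

-- The 312 pattern: t (on B, below n₁) is popped after the token n₂ pushed by the last ρ of the excursion,
-- and before the token c still in A, with t < n₁ ≤ c < n₂.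
leftover-312 : ∀ {t n₁ B₁ O₁ β₁ β₂ γ n₂ A₂ B₂ O₂ n₃ c A₃ O₃ m p} → Avoids312 p → t ℕ.< n₁ → All (ℕ._< n₁) B₁ →
  Run (n₁ , [] , t ∷ B₁ , O₁) β₁ (n₂ , A₂ , B₂ , O₂) →
  Run (suc n₂ , A₂ , n₂ ∷ B₂ , O₂) β₂ (n₃ , c ∷ A₃ , t ∷ B₁ , O₃) → ρ ∉ β₂ →
  Run (n₃ , c ∷ A₃ , B₁ , O₃ ++ t ∷ []) γ (m , [] , [] , p) → ⊥
leftover-312 {t} {n₁} {B₁} {n₂ = n₂} {O₂ = O₂} {c = c} {A₃} avoids t<n₁ B₁<n₁ r₁ r₂ ρ∉β₂ r₃
  with run-invariant window-step r₁ (ℕP.≤-refl , [] , t<n₁ ∷ B₁<n₁) | no-push r₂ ρ∉β₂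
     | conservation r₂ | conservation r₃
... | n₁≤n₂ , A₂-ok , _ | Y , refl | Δ , refl , keep₂ | Δ′ , refl , keep₃ =
  no-312 (subst Avoids312 (++-assoc (O₂ ++ Δ) (t ∷ []) Δ′) avoids) (∈-++⁺ʳ O₂ n₂-out) c-out
         (ℕP.<-≤-trans t<n₁ (proj₁ (in-A₂ (here refl)))) (proj₂ (in-A₂ (here refl)))
  where
  in-A₂ : ∀ {x} → x ∈ c ∷ A₃ → n₁ ℕ.≤ x × x ℕ.< n₂
  in-A₂ x∈ = All.lookup A₂-ok (∈-++⁺ʳ Y x∈)
  n₂-out : n₂ ∈ Δ
  n₂-out with keep₂ (inj₂ (here refl))
  ... | inj₁ n₂∈Δ = n₂∈Δ
  ... | inj₂ (inj₁ n₂∈A) = ⊥-elim (ℕP.<-irrefl refl (proj₂ (in-A₂ n₂∈A)))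
  ... | inj₂ (inj₂ n₂∈B) = ⊥-elim (ℕP.<-irrefl refl (ℕP.<-≤-trans (All.lookup (t<n₁ ∷ B₁<n₁) n₂∈B) n₁≤n₂))
  c-out : c ∈ Δ′
  c-out with keep₃ (inj₁ (here refl))
  ... | inj₁ c∈Δ′ = c∈Δ′
  ... | inj₂ (inj₁ ())
  ... | inj₂ (inj₂ ())

-- An excursion β that leaves a token in A has a last ρ; it is followed by λ′ (else βμ contains ρμ),
-- which yields the 312 pattern above.
no-stranded : ∀ {t n₁ B₁ O₁ β γ n₃ c A₃ O₃ m p} → Avoids312 p → t ℕ.< n₁ → All (ℕ._< n₁) B₁ →
  ¬ HasRM (β ++ μ ∷ []) → Run (n₁ , [] , t ∷ B₁ , O₁) β (n₃ , c ∷ A₃ , t ∷ B₁ , O₃) →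
  Run (n₃ , c ∷ A₃ , B₁ , O₃ ++ t ∷ []) γ (m , [] , [] , p) → ⊥
no-stranded {β = β} avoids t<n₁ B₁<n₁ ¬ρμ r₂ r₃ with last-occurrence _≟_ ρ β
... | inj₁ ρ∉β with no-push r₂ ρ∉β
...   | [] , ()
...   | _ ∷ _ , ()
no-stranded avoids t<n₁ B₁<n₁ ¬ρμ r₂ r₃ | inj₂ (β₁ , [] , refl , _) =
  ¬ρμ (β₁ , [] , ++-assoc β₁ (ρ ∷ []) (μ ∷ []))
no-stranded avoids t<n₁ B₁<n₁ ¬ρμ r₂ r₃ | inj₂ (β₁ , μ ∷ β₂ , refl , _) =
  ¬ρμ (β₁ , β₂ ++ μ ∷ [] , ++-assoc β₁ (ρ ∷ μ ∷ β₂) (μ ∷ []))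
no-stranded avoids t<n₁ B₁<n₁ ¬ρμ r₂ r₃ | inj₂ (β₁ , ρ ∷ β₂ , refl , ρ∉) = ρ∉ (here refl)
no-stranded avoids t<n₁ B₁<n₁ ¬ρμ r₂ r₃ | inj₂ (β₁ , λ′ ∷ β₂ , refl , ρ∉) with run-split β₁ r₂
... | _ , r₁ , push ▸ move ▸ r₂′ = leftover-312 avoids t<n₁ B₁<n₁ r₁ r₂′ (ρ∉ ∘ there) r₃

length-zero : ∀ (X : List ℕ) → + length X ≡ + 0 → X ≡ []
length-zero [] _ = refl
length-zero (_ ∷ _) ()

-- Once t has been moved onto B with A empty, a Dyck excursion β of B brings t back to the top of B; if the
-- output avoids 312 and βμ has no ρμ, then A is empty again.
excursion-empties : ∀ {t n₁ B₁ O₁ β γ m p} → Avoids312 p → t ℕ.< n₁ → All (ℕ._< n₁) B₁ → Dyck λ′ μ β →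
  ¬ HasRM (β ++ μ ∷ []) → Run (n₁ , [] , t ∷ B₁ , O₁) (β ++ μ ∷ γ) (m , [] , [] , p) → hA β ≡ + 0
excursion-empties {β = β} avoids t<n₁ B₁<n₁ (nonneg , β-balanced) ¬ρμ r with run-split β r
... | (n₃ , A₃ , B₃ , O₃) , r₂ , r₃
  with B-frame [] refl refl (λ u v e → subst (+ 0 ≤_) (sym (ℤP.+-identityˡ _)) (nonneg u v e)) r₂
... | X , refl , X-size with length-zero X (trans X-size (trans (ℤP.+-identityˡ _) β-balanced))
... | refl with A₃ | r₂ | A-height r₂ | r₃
... | [] | _ | A-size | _ = sym (trans A-size (ℤP.+-identityˡ _))
... | c ∷ A₃′ | r₂′ | _ | pop ▸ r₄ = ⊥-elim (no-stranded avoids t<n₁ B₁<n₁ ¬ρμ r₂′ r₄)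

avoid312⇒empties : ∀ v p → Generates v p → Avoids312 p → EmptiesA v
avoid312⇒empties v p gen avoids α β γ refl α-level dyck ¬ρμ
  with run-split α (run-sound {length p} 1 [] [] [] v gen)
... | (n₁ , t ∷ A₁ , B₁ , O₁) , r₁ , move ▸ r with A-height r₁
... | A₁-size with length-zero A₁ (cong (_+ -[1+ 0 ]) (trans A₁-size (trans (ℤP.+-identityˡ _) α-level)))
... | refl with run-invariant window-step r₁ (ℕP.≤-refl , [] , [])
... | _ , (_ , t<n₁) ∷ [] , B₁<n₁ = excursion-empties avoids t<n₁ B₁<n₁ dyck ¬ρμ r

-- A nonempty word of 𝓛_{2,∞} is ρ x λ′ v′ μ y: the first ρ is moved at the first return of the A-height
-- (so x is an A-closed walk of height ≤ 1) and popped at the first return of the B-height (so v′ is Dyck for B).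
first-excursion : ∀ v₁ → InLk 2 (ρ ∷ v₁) →
  ∃ λ x → ∃₂ λ v′ y → v₁ ≡ x ++ λ′ ∷ v′ ++ μ ∷ y × Walk 1 x × hA x ≡ + 0 × Dyck λ′ μ v′
first-excursion v₁ v∈L
  with first-return ρ λ′ v₁ (negative-rest {+ 0} (+≤+ ℕ.z≤n)
                                (trans (ℤP.+-identityˡ _) (trans (sym (D-∷ ρ λ′ ρ v₁)) (InLk.endρλ v∈L))))
... | x , y′ , refl , x-nonneg , x-level
  with first-return λ′ μ y′ (negative-rest (proj₂ (proj₂ (InLk.prefixes v∈L (ρ ∷ x) (λ′ ∷ y′) refl))) y′-sum)
  where
  y′-sum : hB x + (+ 1 + hB y′) ≡ + 0
  y′-sum = begin
    hB x + (+ 1 + hB y′)      ≡⟨ cong (λ t → hB x + t) (sym (D-∷ λ′ μ λ′ y′)) ⟩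
    hB x + hB (λ′ ∷ y′)       ≡⟨ sym (D-++ λ′ μ x (λ′ ∷ y′)) ⟩
    hB (x ++ λ′ ∷ y′)         ≡⟨ InLk.endλμ v∈L ⟩
    + 0                       ∎
    where open ≡-Reasoning
... | v′ , y , refl , dyck = x , v′ , y , refl , walk , x-level , dyck
  where
  walk : Walk 1 x
  walk u w e with prefixes-infix (ρ ∷ []) x (λ′ ∷ v′ ++ μ ∷ y) (InLk.prefixes v∈L) u w e
  ... | _ , hi , b = x-nonneg u w e , below-2 (hA u) (subst (_≤ + 2) (D-∷ ρ λ′ ρ u) hi) , b

reassoc : ∀ (x v y r : Word) → (x ++ λ′ ∷ v ++ μ ∷ y) ++ μ ∷ r ≡ x ++ λ′ ∷ v ++ μ ∷ y ++ μ ∷ r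
reassoc x v y r = trans (++-assoc x (λ′ ∷ v ++ μ ∷ y) (μ ∷ r)) (cong (λ t → x ++ λ′ ∷ t) (++-assoc v (μ ∷ y) (μ ∷ r)))

empties-inner : ∀ x v′ y → hA (ρ ∷ x) ≡ + 1 → EmptiesA (ρ ∷ x ++ λ′ ∷ v′ ++ μ ∷ y) → EmptiesA v′
empties-inner x v′ y ρx-level empties α β γ refl α-level =
  empties (ρ ∷ x ++ λ′ ∷ α) β (γ ++ μ ∷ y) regroup (trans (after-λ (ρ ∷ x) α ρx-level) α-level)
  where
  regroup : ρ ∷ x ++ λ′ ∷ (α ++ λ′ ∷ β ++ μ ∷ γ) ++ μ ∷ y ≡ (ρ ∷ x ++ λ′ ∷ α) ++ λ′ ∷ β ++ μ ∷ γ ++ μ ∷ y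
  regroup = cong (ρ ∷_) (trans (cong (λ t → x ++ λ′ ∷ t) (reassoc α β γ y)) (sym (++-assoc x (λ′ ∷ α) _)))

length-inner : ∀ (x v′ y : Word) → length v′ ℕ.< length (ρ ∷ x ++ λ′ ∷ v′ ++ μ ∷ y)
length-inner x v′ y = ℕ.s≤s (ℕP.≤-trans (length-++-≤ˡ v′)
  (ℕP.≤-trans (ℕP.n≤1+n _) (length-++-≤ʳ (λ′ ∷ v′ ++ μ ∷ y) {x})))

HasRM-inside : ∀ Q r {z} → HasRM z → HasRM (Q ++ λ′ ∷ (ρ ∷ z) ++ μ ∷ r)
HasRM-inside Q r h = HasRM-++ʳ Q (HasRM-++ʳ (λ′ ∷ ρ ∷ []) (HasRM-++ˡ (μ ∷ r) h))

blocked : ∀ {Q} v r → Acc ℕ._<_ (length v) → Stem Q → InLk 2 v → EmptiesA v → ¬ InL (Q ++ λ′ ∷ v ++ μ ∷ r)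
blocked [] r _ stem _ _ = stem-blocks stem r
blocked (λ′ ∷ v) r _ _ v∈L _ _ with proj₁ (InLk.prefixes v∈L (λ′ ∷ []) v refl)
... | ()
blocked (μ ∷ v) r _ _ v∈L _ _ with proj₂ (proj₂ (InLk.prefixes v∈L (μ ∷ []) v refl))
... | ()
blocked {Q} (ρ ∷ v₁) r (acc shorter) stem v∈L empties inL with first-excursion v₁ v∈L
... | x , v′ , y , refl , walk , x-level , dyck with stem-extend x stem walk x-level
...   | inj₂ ρμ-in-x = InL.noρμ inL (HasRM-inside Q r (HasRM-++ˡ (λ′ ∷ v′ ++ μ ∷ y) ρμ-in-x))
...   | inj₁ stem′ =
  blocked v′ (y ++ μ ∷ r) (shorter (length-inner x v′ y)) stem′ v′∈L (empties-inner x v′ y ρx-level empties)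
    (subst InL regroup inL)
  where
  -- v′μ contains no ρμ, so the excursion property empties A after v′, whence v′ ∈ 𝓛_{2,∞}
  ¬ρμ : ¬ HasRM (v′ ++ μ ∷ [])
  ¬ρμ h = InL.noρμ inL (HasRM-inside Q r (HasRM-++ʳ x (HasRM-++ʳ (λ′ ∷ [])
            (subst HasRM (++-assoc v′ (μ ∷ []) y) (HasRM-++ˡ y h)))))
  ρx-level : hA (ρ ∷ x) ≡ + 1
  ρx-level = trans (D-∷ ρ λ′ ρ x) (cong (λ t → + 1 + t) x-level)
  v′∈L : InLk 2 v′
  v′∈L = inLk-after-λ (ρ ∷ x) v′ (μ ∷ y) (InLk.prefixes v∈L) ρx-level
           (empties (ρ ∷ x) v′ y refl ρx-level dyck ¬ρμ) dyck
  regroup : Q ++ λ′ ∷ (ρ ∷ x ++ λ′ ∷ v′ ++ μ ∷ y) ++ μ ∷ r ≡ (Q ++ λ′ ∷ ρ ∷ x) ++ λ′ ∷ v′ ++ μ ∷ y ++ μ ∷ r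
  regroup = trans (cong (λ t → Q ++ λ′ ∷ ρ ∷ t) (reassoc x v′ y r)) (sym (++-assoc Q (λ′ ∷ ρ ∷ x) _))

-- Lemma 3.7: both hypotheses say that w = Q λ′ w₂ μ w₃ for a stem Q, and w₂ has the excursion property.
lemma3p7 : (w : Word) → InLk 2 w →
    ((∃ λ w₀ → ∃ λ w₁ → ∃ λ w₂ → ∃ λ w₃ →
        (w ≡ w₀ ++ ρ ∷ λ′ ∷ w₁ ++ λ′ ∷ w₂ ++ μ ∷ w₃) × D ρ λ′ w₀ ≡ + 1 × InLk 1 w₁ ×
        InLk 2 w₂ × (∃ λ (p : List ℕ) → Generates w₂ p × Avoids312 p))
    ⊎ (∃ λ w₀ → ∃ λ w₁ → ∃ λ w₂ → ∃ λ w₃ →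
        (w ≡ w₀ ++ λ′ ∷ ρ ∷ w₁ ++ λ′ ∷ w₂ ++ μ ∷ w₃) × D ρ λ′ w₀ ≡ + 1 × InLk 1 w₁ ×
        InLk 2 w₂ × (∃ λ (p : List ℕ) → Generates w₂ p × Avoids312 p))) →
    ¬ InL w
lemma3p7 _ _ (inj₁ (w₀ , w₁ , w₂ , w₃ , refl , w₀-level , w₁∈L , w₂∈L , p , gen , avoids)) =
  subst (λ w → ¬ InL w) (++-assoc w₀ (ρ ∷ λ′ ∷ w₁) (λ′ ∷ w₂ ++ μ ∷ w₃))
    (blocked w₂ w₃ (<-wellFounded _) (via-ρλ w₀-level w₁∈L) w₂∈L (avoid312⇒empties w₂ p gen avoids))
lemma3p7 _ _ (inj₂ (w₀ , w₁ , w₂ , w₃ , refl , w₀-level , w₁∈L , w₂∈L , p , gen , avoids)) =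
  subst (λ w → ¬ InL w) (++-assoc w₀ (λ′ ∷ ρ ∷ w₁) (λ′ ∷ w₂ ++ μ ∷ w₃))
    (blocked w₂ w₃ (<-wellFounded _) (via-λρ w₀-level w₁∈L) w₂∈L (avoid312⇒empties w₂ p gen avoids))
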